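{- Let $B$ be a non-empty finite set. The scheme "for every predicate $T$ on $B^*$, if $T$ is a tree and staged infinite then $T$ has an infinite branch" is equivalent to the scheme "for every predicate $T$ on $B^*$, if $T$ has unbounded paths then $T$ has an infinite branch". Likewise, the scheme "for every predicate $T$ on $B^*$, if $T$ is barred and monotone then $T$ is staged barred" is equivalent to the scheme "for every predicate $T$ on $B^*$, if $T$ is barred then $T$ is uniformly barred".
   Context: $B^*$ is the set of finite sequences over $B$; $u\star b$ is the extension of $u$ by $b$, $|u|$ the length, $u'\leq_s u$ means $u'$ is a prefix of $u$; for $\alpha:\mathbb{N}\to B$, $u\prec_s\alpha$ means $u(i)=\alpha(i)$ for $i<|u|$. $T$ is a tree if $\forall u\,\forall b\,(u\star b\in T\Rightarrow u\in T)$; monotone if $\forall u\,\forall b\,(u\in T\Rightarrow u\star b\in T)$. $T^{\downarrow}=\{u\mid\forall u'\leq_s u,\ u'\in T\}$, $T^{\uparrow}=\{u\mid\exists u'\leq_s u,\ u'\in T\}$. $T$ has unbounded paths if $\forall n\,\exists u\,(|u|=n\wedge u\in T^{\downarrow})$; staged infinite if $\forall n\,\exists u\,(|u|=n\wedge u\in T)$; uniformly barred if $\exists n\,\forall u\,(|u|=n\Rightarrow u\in T^{\uparrow})$; staged barred if $\exists n\,\forall u\,(|u|=n\Rightarrow u\in T)$; has an infinite branch if $\exists\alpha\,\forall u\,(u\prec_s\alpha\Rightarrow u\in T)$; barred if $\forall\alpha\,\exists u\,(u\prec_s\alpha\wedge u\in T)$. -}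

module Defs where

open import Data.Nat using (ℕ)
open import Data.Fin using (Fin; toℕ)
open import Data.List using (List; []; _∷_; _++_; [_]; length; lookup)
open import Data.List.Relation.Binary.Prefix.Heterogeneous using (Prefix)
open import Data.Product using (Σ; ∃; ∃-syntax; _×_)
open import Relation.Binary.PropositionalEquality using (_≡_)

module _ {B : Set} where

  _⋆_ : List B → B → List B
  u ⋆ b = u ++ [ b ]

  _≤s_ : List B → List B → Set
  u' ≤s u = Prefix _≡_ u' u

  _≺s_ : List B → (ℕ → B) → Set
  u ≺s α = (i : Fin (length u)) → lookup u i ≡ α (toℕ i)

  IsTree : (List B → Set) → Set
  IsTree T = ∀ u b → T (u ⋆ b) → T u

  IsMonotone : (List B → Set) → Set
  IsMonotone T = ∀ u b → T u → T (u ⋆ b)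

  _↓ : (List B → Set) → List B → Set
  (T ↓) u = ∀ u' → u' ≤s u → T u'

  _↑ : (List B → Set) → List B → Set
  (T ↑) u = ∃[ u' ] (u' ≤s u × T u')

  HasUnboundedPaths : (List B → Set) → Set
  HasUnboundedPaths T = ∀ (n : ℕ) → ∃[ u ] (length u ≡ n × (T ↓) u)

  StagedInfinite : (List B → Set) → Set
  StagedInfinite T = ∀ (n : ℕ) → ∃[ u ] (length u ≡ n × T u)

  UniformlyBarred : (List B → Set) → Set
  UniformlyBarred T = ∃[ n ] (∀ u → length u ≡ n → (T ↑) u)

  StagedBarred : (List B → Set) → Set
  StagedBarred T = ∃[ n ] (∀ u → length u ≡ n → T u)

  HasInfiniteBranch : (List B → Set) → Set
  HasInfiniteBranch T = Σ (ℕ → B) λ α → ∀ u → u ≺s α → T u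

  Barred : (List B → Set) → Set
  Barred T = ∀ (α : ℕ → B) → ∃[ u ] (u ≺s α × T u)

WKL-staged : (B : Set) → Set₁
WKL-staged B = (T : List B → Set) → IsTree T → StagedInfinite T → HasInfiniteBranch T

WKL-unbounded : (B : Set) → Set₁
WKL-unbounded B = (T : List B → Set) → HasUnboundedPaths T → HasInfiniteBranch T

FAN-monotone : (B : Set) → Set₁
FAN-monotone B = (T : List B → Set) → Barred T → IsMonotone T → StagedBarred T

FAN-uniform : (B : Set) → Set₁
FAN-uniform B = (T : List B → Set) → Barred T → UniformlyBarred T

module Submission where

-- T ↓ is the largest tree contained in T and T ↑ the smallest monotone
-- predicate containing T.  "T has unbounded paths" is literally "T ↓ is
-- staged infinite" and "T is uniformly barred" is "T ↑ is staged barred";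
-- since infinite branches, staged infinity, bars and staged bars all transfer
-- along inclusions, each scheme instantiated at T ↓ (resp. T ↑) gives the
-- other.

open import Defs
open import Data.Nat using (ℕ; suc)
open import Data.Fin using (Fin)
open import Data.List using (List; []; _∷_; _++_; [_])
open import Data.List.Properties using (++-assoc; ++-identityʳ)
import Data.List.Relation.Binary.Pointwise as Pointwise
open import Data.List.Relation.Binary.Pointwise using (Pointwise-≡⇒≡)
open import Data.List.Relation.Binary.Prefix.Heterogeneous
  using (_++ᵖ_; toView) renaming (_++_ to _++ᵛ_)
open import Data.List.Relation.Binary.Prefix.Heterogeneous.Properties
  using (fromPointwise)
open import Data.Product using (_×_; _,_)
open import Function.Bundles using (_↔_; _⇔_; mk⇔)
open import Relation.Binary.PropositionalEquality using (refl; subst; sym)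
open import Relation.Unary using (_⊆_)

module _ {B : Set} where

  ≤s-refl : (u : List B) → u ≤s u
  ≤s-refl u = fromPointwise (Pointwise.refl refl)

  module _ {T S : List B → Set} (T⊆S : T ⊆ S) where

    stagedInfinite-mono : StagedInfinite T → StagedInfinite S
    stagedInfinite-mono inf n = let (u , |u|≡n , t) = inf n in u , |u|≡n , T⊆S t

    stagedBarred-mono : StagedBarred T → StagedBarred S
    stagedBarred-mono (n , bar) = n , λ u |u|≡n → T⊆S (bar u |u|≡n)

    hasInfiniteBranch-mono : HasInfiniteBranch T → HasInfiniteBranch S
    hasInfiniteBranch-mono (α , branch) = α , λ u u≺α → T⊆S (branch u u≺α)

    barred-mono : Barred T → Barred S
    barred-mono bar α = let (u , u≺α , t) = bar α in u , u≺α , T⊆S t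

  module _ {T : List B → Set} where

    ↓-isTree : IsTree (T ↓)
    ↓-isTree u b t u' u'≤u = t u' (u'≤u ++ᵖ [ b ])

    ↓⊆ : T ↓ ⊆ T
    ↓⊆ {u} t = t u (≤s-refl u)

    ↑-isMonotone : IsMonotone (T ↑)
    ↑-isMonotone u b (u' , u'≤u , t) = u' , u'≤u ++ᵖ [ b ] , t

    ⊆↑ : T ⊆ T ↑
    ⊆↑ {u} t = u , ≤s-refl u , t

    tree-++⁻ : IsTree T → ∀ u v → T (u ++ v) → T u
    tree-++⁻ tree u []      t = subst T (++-identityʳ u) t
    tree-++⁻ tree u (b ∷ v) t =
      tree u b (tree-++⁻ tree (u ⋆ b) v (subst T (sym (++-assoc u [ b ] v)) t))

    tree⇒⊆↓ : IsTree T → T ⊆ T ↓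
    tree⇒⊆↓ tree t u' u'≤u with toView u'≤u
    ... | u'≋w ++ᵛ v with refl ← Pointwise-≡⇒≡ u'≋w =
      tree-++⁻ tree u' v t

    monotone-++⁺ : IsMonotone T → ∀ u v → T u → T (u ++ v)
    monotone-++⁺ mono u []      t = subst T (sym (++-identityʳ u)) t
    monotone-++⁺ mono u (b ∷ v) t =
      subst T (++-assoc u [ b ] v) (monotone-++⁺ mono (u ⋆ b) v (mono u b t))

    monotone⇒↑⊆ : IsMonotone T → T ↑ ⊆ T
    monotone⇒↑⊆ mono (u' , u'≤u , t) with toView u'≤u
    ... | u'≋w ++ᵛ v with refl ← Pointwise-≡⇒≡ u'≋w =
      monotone-++⁺ mono u' v t

proposition7 : (B : Set) (n : ℕ) → B ↔ Fin (suc n) →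
    (WKL-staged B ⇔ WKL-unbounded B) × (FAN-monotone B ⇔ FAN-uniform B)
proposition7 B _ _ = mk⇔ staged⇒unbounded unbounded⇒staged
                   , mk⇔ monotone⇒uniform uniform⇒monotone
  where
  staged⇒unbounded : WKL-staged B → WKL-unbounded B
  staged⇒unbounded wkl T unbounded =
    hasInfiniteBranch-mono ↓⊆ (wkl (T ↓) ↓-isTree unbounded)

  unbounded⇒staged : WKL-unbounded B → WKL-staged B
  unbounded⇒staged wkl T tree inf =
    wkl T (stagedInfinite-mono (tree⇒⊆↓ tree) inf)

  monotone⇒uniform : FAN-monotone B → FAN-uniform B
  monotone⇒uniform fan T bar = fan (T ↑) (barred-mono ⊆↑ bar) ↑-isMonotone

  uniform⇒monotone : FAN-uniform B → FAN-monotone B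
  uniform⇒monotone fan T bar mono =
    stagedBarred-mono (monotone⇒↑⊆ mono) (fan T bar)
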